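{- Let $G$ be a simple graph, $D$ a positive integer with $D\ge\Delta(G)$, and $\pi$ a partial $D$-edge-coloring of $G$. If a fan $F=(x,y_1,\ldots,y_k)$ is not active, then $\left|\bigcup_{i=1}^k\bar\pi(y_i)\right|\ge D-d(y_1)+k$.
   Context: A partial $D$-edge-coloring of $G$ is a function $\pi:E(G)\to\{1,\ldots,D\}\cup\{\bot\}$ ($\bot$ meaning uncolored) such that incident edges both colored from $\{1,\ldots,D\}$ get different colors. For a vertex $v$, $\pi(v)=\{\pi(vw):w\in N(v)\}\setminus\{\bot\}$ and $\bar\pi(v)=\{1,\ldots,D\}\setminus\pi(v)$. A fan is a sequence $F=(x,y_1,\ldots,y_k)$ such that (F1) $y_1,\ldots,y_k$ are distinct neighbors of $x$; (F2) $xy_1$ is uncolored; (F3) for $i=2,\ldots,k$, $xy_i$ is colored and $\pi(xy_i)\in\bigcup_{j<i}\bar\pi(y_j)$; (F4) for $i=2,\ldots,k$, $d(y_i)<D$. A fan is active if (A1) $\bar\pi(y_i)\cap\bar\pi(x)\neq\emptyset$ for some $i\in\{1,\ldots,k\}$, or (A2) $\bar\pi(y_i)\cap\bar\pi(y_j)\neq\emptyset$ for some distinct $i,j\in\{1,\ldots,k\}$. -}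

module Defs where

open import Data.Nat using (ℕ; suc; _≤_; _<_)
open import Data.Bool using (Bool; true; false; not; _∧_)
open import Data.Fin using (Fin; zero; suc) renaming (_<_ to _<ᶠ_)
import Data.Fin as Fin
open import Data.Fin.Subset using (Subset; _∈_; ⋃; ∣_∣)
open import Data.Vec using (tabulate)
open import Data.List using (List; allFin; map)
open import Data.Bool.ListAction using (any)
open import Data.Maybe using (Maybe; just; nothing)
open import Data.Product using (Σ; ∃; _×_; _,_)
open import Data.Sum using (_⊎_)
open import Data.Empty using (⊥)
open import Relation.Nullary using (¬_; isYes)
open import Relation.Binary.PropositionalEquality using (_≡_; _≢_)

record Graph (n : ℕ) : Set where
  field
    adj   : Fin n → Fin n → Bool
    sym   : ∀ u v → adj u v ≡ adj v u
    irrefl : ∀ v → adj v v ≡ false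
open Graph public

deg : ∀ {n} → Graph n → Fin n → ℕ
deg G v = ∣ tabulate (adj G v) ∣

maxDeg≤ : ∀ {n} → Graph n → ℕ → Set
maxDeg≤ G D = ∀ v → deg G v ≤ D

-- An assignment of colours {1..D} (as Fin D) or ⊥ (nothing) to edges,
-- given on ordered vertex pairs and required symmetric; values on
-- non-adjacent pairs are irrelevant.
Colouring : ℕ → ℕ → Set
Colouring n D = Fin n → Fin n → Maybe (Fin D)

record IsPartialColouring {n} (G : Graph n) (D : ℕ) (π : Colouring n D) : Set where
  field
    symm   : ∀ u v → π u v ≡ π v u
    proper : ∀ v w₁ w₂ (c : Fin D) → adj G v w₁ ≡ true → adj G v w₂ ≡ true →
             w₁ ≢ w₂ → π v w₁ ≡ just c → π v w₂ ≡ just c → ⊥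

hasColour : ∀ {D} → Maybe (Fin D) → Fin D → Bool
hasColour (just d) c = isYes (d Fin.≟ c)
hasColour nothing  c = false

used : ∀ {n D} → Graph n → Colouring n D → Fin n → Fin D → Bool
used G π v c = any (λ w → adj G v w ∧ hasColour (π v w) c) (allFin _)

missing : ∀ {n D} → Graph n → Colouring n D → Fin n → Subset D
missing G π v = tabulate (λ c → not (used G π v c))

-- Fan F = (x, y₁, …, y_k), k = suc m, yᵢ = ys (i-1)
record IsFan {n D} (G : Graph n) (π : Colouring n D) (x : Fin n) (m : ℕ)
             (ys : Fin (suc m) → Fin n) : Set where
  field
    distinct : ∀ i j → ys i ≡ ys j → i ≡ j
    nbr      : ∀ i → adj G x (ys i) ≡ true
    uncol    : π x (ys zero) ≡ nothing
    -- (F3) for y_{i+1}, i ≥ 1 (index suc i): colour missing at some earlier y_j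
    col      : ∀ (i : Fin m) → ∃ λ (c : Fin D) → π x (ys (suc i)) ≡ just c ×
                 ∃ λ (j : Fin (suc m)) → j <ᶠ suc i × c ∈ missing G π (ys j)
    lowdeg   : ∀ (i : Fin m) → deg G (ys (suc i)) < D

Active : ∀ {n D} → Graph n → Colouring n D → Fin n → (m : ℕ) →
         (Fin (suc m) → Fin n) → Set
Active {D = D} G π x m ys =
  (∃ λ i → ∃ λ (c : Fin D) → c ∈ missing G π (ys i) × c ∈ missing G π x)
  ⊎ (∃ λ i → ∃ λ j → i ≢ j × ∃ λ (c : Fin D) →
       c ∈ missing G π (ys i) × c ∈ missing G π (ys j))

fanMissing : ∀ {n D} → Graph n → Colouring n D → (m : ℕ) →
             (Fin (suc m) → Fin n) → Subset D
fanMissing G π m ys = ⋃ (map (λ i → missing G π (ys i)) (allFin (suc m)))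

{-# OPTIONS --safe #-}
-- Since the edge xy₁ is uncoloured, y₁ sees at most d(y₁) − 1 colours, so
-- |π̄(y₁)| ≥ D − d(y₁) + 1; every other yᵢ has d(yᵢ) < D and so misses at least
-- one colour. In an inactive fan the sets π̄(yᵢ) are pairwise disjoint (this is
-- the failure of (A2)), so the size of their union is the sum of their sizes.
module Submission where

open import Data.Bool using (Bool; true; T; not; _∧_)
open import Data.Bool.Properties using (T-≡; T-∧)
open import Data.Empty using (⊥-elim)
open import Data.Fin using (Fin; zero) renaming (suc to fsuc)
open import Data.Fin.Properties using (suc-injective; 0≢1+n)
open import Data.Fin.Subset
  using (Subset; inside; outside; _∈_; _∉_; _⊆_; _∪_; _∩_; ⋃; ∣_∣; Empty)
open import Data.Fin.Subset.Properties
  using ( x∈p∪q⁻; x∈p∪q⁺; x∈p∩q⁻; x∈p∩q⁺; drop-there; drop-∷-Empty; ∉⊥; Empty-unique; ∣⊥∣≡0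
        ; ∣∁p∣≡n∸∣p∣; p⊆q⇒∣p∣≤∣q∣; p⊂q⇒∣p∣<∣q∣ )
open import Data.List
  using (List; []; _∷_; allFin) renaming (tabulate to tabulateᴸ; map to mapᴸ)
open import Data.List.Properties using (map-tabulate)
open import Data.List.Relation.Unary.All as All using ()
open import Data.List.Relation.Unary.Any as Any using (Any)
open import Data.List.Relation.Unary.Any.Properties
  using (any⁻) renaming (tabulate⁺ to Any-tabulate⁺; tabulate⁻ to Any-tabulate⁻)
open import Data.List.Relation.Unary.AllPairs using (AllPairs; []; _∷_)
open import Data.List.Relation.Unary.AllPairs.Properties
  using () renaming (tabulate⁺ to AllPairs-tabulate⁺)
open import Data.Maybe using (Maybe; just; nothing; is-just)
open import Data.Nat using (ℕ; zero; suc; _≤_; _<_; _+_; _∸_; z≤n; s≤s)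
open import Data.Nat.ListAction using (sum)
open import Data.Nat.Properties
  using ( ≤-trans; ≤-reflexive; ≤-<-trans; +-mono-≤; +-monoʳ-≤; +-suc; n≤1+n; ∸-monoʳ-<; m<n⇒0<n∸m
        ; module ≤-Reasoning )
open import Data.Product using (_×_; _,_; proj₁; proj₂)
open import Data.Sum using (inj₁; inj₂)
open import Data.Vec using ([]; _∷_; here; there; tabulate)
open import Data.Vec.Properties using (lookup∘tabulate; lookup⇒[]=; []=⇒lookup; tabulate-∘)
open import Function using (_∘_; Equivalence)
open import Relation.Binary.PropositionalEquality using (_≡_; refl; sym; trans; cong; subst; _≢_)
open import Relation.Nullary using (¬_)
open import Relation.Nullary.Decidable using (toWitness)

open import Defs hiding (sym)

private
  variable
    k n : ℕ

Disjoint : Subset n → Subset n → Set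
Disjoint p q = Empty (p ∩ q)

∈-tabulate⁺ : {f : Fin n → Bool} {x : Fin n} → T (f x) → x ∈ tabulate f
∈-tabulate⁺ {f = f} {x} t =
  lookup⇒[]= x (tabulate f) (trans (lookup∘tabulate f x) (Equivalence.to T-≡ t))

∈-tabulate⁻ : {f : Fin n → Bool} {x : Fin n} → x ∈ tabulate f → T (f x)
∈-tabulate⁻ {f = f} {x} x∈ =
  Equivalence.from T-≡ (trans (sym (lookup∘tabulate f x)) ([]=⇒lookup x∈))

Empty⇒∣p∣≡0 : {p : Subset n} → Empty p → ∣ p ∣ ≡ 0
Empty⇒∣p∣≡0 {n} empty = trans (cong ∣_∣ (Empty-unique empty)) (∣⊥∣≡0 n)

subsingleton⇒∣p∣≤1 : {p : Subset n} → (∀ {x y} → x ∈ p → y ∈ p → x ≡ y) → ∣ p ∣ ≤ 1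
subsingleton⇒∣p∣≤1 {p = []}          _ = z≤n
subsingleton⇒∣p∣≤1 {p = outside ∷ p} u =
  subsingleton⇒∣p∣≤1 (λ x∈ y∈ → suc-injective (u (there x∈) (there y∈)))
subsingleton⇒∣p∣≤1 {p = inside ∷ p}  u =
  s≤s (≤-reflexive (Empty⇒∣p∣≡0 (λ (x , x∈) → 0≢1+n (u here (there x∈)))))

∣p∪q∣≤∣p∣+∣q∣ : (p q : Subset n) → ∣ p ∪ q ∣ ≤ ∣ p ∣ + ∣ q ∣
∣p∪q∣≤∣p∣+∣q∣ []            []            = z≤n
∣p∪q∣≤∣p∣+∣q∣ (inside ∷ p)  (inside ∷ q)  =
  s≤s (≤-trans (∣p∪q∣≤∣p∣+∣q∣ p q) (+-monoʳ-≤ ∣ p ∣ (n≤1+n ∣ q ∣)))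
∣p∪q∣≤∣p∣+∣q∣ (inside ∷ p)  (outside ∷ q) = s≤s (∣p∪q∣≤∣p∣+∣q∣ p q)
∣p∪q∣≤∣p∣+∣q∣ (outside ∷ p) (inside ∷ q)  =
  ≤-trans (s≤s (∣p∪q∣≤∣p∣+∣q∣ p q)) (≤-reflexive (sym (+-suc ∣ p ∣ ∣ q ∣)))
∣p∪q∣≤∣p∣+∣q∣ (outside ∷ p) (outside ∷ q) = ∣p∪q∣≤∣p∣+∣q∣ p q

∣p∪q∣≡∣p∣+∣q∣ : (p q : Subset n) → Disjoint p q → ∣ p ∪ q ∣ ≡ ∣ p ∣ + ∣ q ∣
∣p∪q∣≡∣p∣+∣q∣ []            []            _    = refl
∣p∪q∣≡∣p∣+∣q∣ (inside ∷ p)  (inside ∷ q)  disj = ⊥-elim (disj (zero , here))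
∣p∪q∣≡∣p∣+∣q∣ (inside ∷ p)  (outside ∷ q) disj =
  cong suc (∣p∪q∣≡∣p∣+∣q∣ p q (drop-∷-Empty disj))
∣p∪q∣≡∣p∣+∣q∣ (outside ∷ p) (inside ∷ q)  disj =
  trans (cong suc (∣p∪q∣≡∣p∣+∣q∣ p q (drop-∷-Empty disj))) (sym (+-suc ∣ p ∣ ∣ q ∣))
∣p∪q∣≡∣p∣+∣q∣ (outside ∷ p) (outside ∷ q) disj = ∣p∪q∣≡∣p∣+∣q∣ p q (drop-∷-Empty disj)

x∈⋃⁻ : {ps : List (Subset n)} {x : Fin n} → x ∈ ⋃ ps → Any (x ∈_) ps
x∈⋃⁻ {ps = []}     x∈ = ⊥-elim (∉⊥ x∈)
x∈⋃⁻ {ps = p ∷ ps} x∈ with x∈p∪q⁻ p (⋃ ps) x∈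
... | inj₁ x∈p  = Any.here x∈p
... | inj₂ x∈ps = Any.there (x∈⋃⁻ x∈ps)

x∈⋃⁺ : {ps : List (Subset n)} {x : Fin n} → Any (x ∈_) ps → x ∈ ⋃ ps
x∈⋃⁺ (Any.here x∈p)   = x∈p∪q⁺ (inj₁ x∈p)
x∈⋃⁺ (Any.there x∈ps) = x∈p∪q⁺ (inj₂ (x∈⋃⁺ x∈ps))

∣⋃∣≡sum : {ps : List (Subset n)} → AllPairs Disjoint ps → ∣ ⋃ ps ∣ ≡ sum (mapᴸ ∣_∣ ps)
∣⋃∣≡sum {n} {[]}      []                    = ∣⊥∣≡0 n
∣⋃∣≡sum {ps = p ∷ ps} (disjoint ∷ pairwise) =
  trans (∣p∪q∣≡∣p∣+∣q∣ p (⋃ ps) disjointFromUnion) (cong (∣ p ∣ +_) (∣⋃∣≡sum pairwise))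
  where
  disjointFromUnion : Disjoint p (⋃ ps)
  disjointFromUnion (x , x∈p∩⋃) with x∈p∩q⁻ p (⋃ ps) x∈p∩⋃
  ... | x∈p , x∈⋃ =
    All.lookupWith (λ disj x∈q → disj (x , x∈p∩q⁺ (x∈p , x∈q))) disjoint (x∈⋃⁻ x∈⋃)

∣⋃-tabulate∣≡sum : {f : Fin k → Subset n} → (∀ {i j} → i ≢ j → Disjoint (f i) (f j)) →
                   ∣ ⋃ (tabulateᴸ f) ∣ ≡ sum (tabulateᴸ (∣_∣ ∘ f))
∣⋃-tabulate∣≡sum {f = f} disjoint =
  trans (∣⋃∣≡sum (AllPairs-tabulate⁺ disjoint)) (cong sum (map-tabulate f ∣_∣))

∣⋃∣≤∣support∣ : (f : Fin k → Subset n) (q : Subset k) → (∀ i → ∣ f i ∣ ≤ 1) →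
               (∀ {i x} → x ∈ f i → i ∈ q) → ∣ ⋃ (tabulateᴸ f) ∣ ≤ ∣ q ∣
∣⋃∣≤∣support∣ {n = n} f [] _ _ = ≤-reflexive (∣⊥∣≡0 n)
∣⋃∣≤∣support∣ f (inside ∷ q) ≤1 support = begin
  ∣ f zero ∪ ⋃ rest ∣        ≤⟨ ∣p∪q∣≤∣p∣+∣q∣ (f zero) (⋃ rest) ⟩
  ∣ f zero ∣ + ∣ ⋃ rest ∣    ≤⟨ +-mono-≤ (≤1 zero) (∣⋃∣≤∣support∣ (f ∘ fsuc) q (≤1 ∘ fsuc) (drop-there ∘ support)) ⟩
  1 + ∣ q ∣                  ∎
  where
  open ≤-Reasoning
  rest : List (Subset _)
  rest = tabulateᴸ (f ∘ fsuc)
∣⋃∣≤∣support∣ f (outside ∷ q) ≤1 support = begin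
  ∣ f zero ∪ ⋃ rest ∣        ≤⟨ ∣p∪q∣≤∣p∣+∣q∣ (f zero) (⋃ rest) ⟩
  ∣ f zero ∣ + ∣ ⋃ rest ∣    ≡⟨ cong (_+ ∣ ⋃ rest ∣) (Empty⇒∣p∣≡0 f₀-empty) ⟩
  ∣ ⋃ rest ∣                 ≤⟨ ∣⋃∣≤∣support∣ (f ∘ fsuc) q (≤1 ∘ fsuc) (drop-there ∘ support) ⟩
  ∣ q ∣                      ∎
  where
  open ≤-Reasoning
  rest : List (Subset _)
  rest = tabulateᴸ (f ∘ fsuc)
  f₀-empty : Empty (f zero)
  f₀-empty (x , x∈) with support x∈
  ... | ()

k≤sum-tabulate : {g : Fin k → ℕ} → (∀ i → 0 < g i) → k ≤ sum (tabulateᴸ g)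
k≤sum-tabulate {zero}  _        = z≤n
k≤sum-tabulate {suc k} positive = +-mono-≤ (positive zero) (k≤sum-tabulate (positive ∘ fsuc))

hasColour-functional : {D : ℕ} {e : Maybe (Fin D)} {c c′ : Fin D} →
                       T (hasColour e c) → T (hasColour e c′) → c ≡ c′
hasColour-functional {e = just d} d≡c d≡c′ = trans (sym (toWitness d≡c)) (toWitness d≡c′)

hasColour⇒is-just : {D : ℕ} {e : Maybe (Fin D)} {c : Fin D} → T (hasColour e c) → T (is-just e)
hasColour⇒is-just {e = just _} _ = _

module _ {D : ℕ} (G : Graph n) (π : Colouring n D) where

  usedColours : Fin n → Subset D
  usedColours v = tabulate (used G π v)

  colourOf : Fin n → Fin n → Subset D
  colourOf v w = tabulate (λ c → adj G v w ∧ hasColour (π v w) c)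

  neighbours : Fin n → Subset n
  neighbours v = tabulate (adj G v)

  colouredNeighbours : Fin n → Subset n
  colouredNeighbours v = tabulate (λ w → adj G v w ∧ is-just (π v w))

  ∣missing∣≡D∸∣usedColours∣ : ∀ v → ∣ missing G π v ∣ ≡ D ∸ ∣ usedColours v ∣
  ∣missing∣≡D∸∣usedColours∣ v =
    trans (cong ∣_∣ (tabulate-∘ not (used G π v))) (∣∁p∣≡n∸∣p∣ (usedColours v))

  ∈colourOf⁻ : ∀ {v w c} → c ∈ colourOf v w → T (adj G v w) × T (hasColour (π v w) c)
  ∈colourOf⁻ {v} {w} c∈ =
    Equivalence.to T-∧ (∈-tabulate⁻ {f = λ c → adj G v w ∧ hasColour (π v w) c} c∈)

  ∈colouredNeighbours⁻ : ∀ {v w} → w ∈ colouredNeighbours v → T (adj G v w) × T (is-just (π v w))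
  ∈colouredNeighbours⁻ {v} w∈ =
    Equivalence.to T-∧ (∈-tabulate⁻ {f = λ w → adj G v w ∧ is-just (π v w)} w∈)

  usedColours⊆⋃colourOf : ∀ v → usedColours v ⊆ ⋃ (tabulateᴸ (colourOf v))
  usedColours⊆⋃colourOf v c∈ with Any-tabulate⁻ (any⁻ _ (allFin n) (∈-tabulate⁻ c∈))
  ... | w , c∈vw = x∈⋃⁺ (Any-tabulate⁺ w (∈-tabulate⁺ c∈vw))

  ∣colourOf∣≤1 : ∀ v w → ∣ colourOf v w ∣ ≤ 1
  ∣colourOf∣≤1 v w = subsingleton⇒∣p∣≤1 λ c∈ c′∈ →
    hasColour-functional {e = π v w} (proj₂ (∈colourOf⁻ c∈)) (proj₂ (∈colourOf⁻ c′∈))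

  ∈colourOf⇒∈colouredNeighbours : ∀ {v w c} → c ∈ colourOf v w → w ∈ colouredNeighbours v
  ∈colourOf⇒∈colouredNeighbours c∈ with ∈colourOf⁻ c∈
  ... | vw∈G , c∈vw = ∈-tabulate⁺ (Equivalence.from T-∧ (vw∈G , hasColour⇒is-just c∈vw))

  colouredNeighbours⊆neighbours : ∀ {v} → colouredNeighbours v ⊆ neighbours v
  colouredNeighbours⊆neighbours w∈ = ∈-tabulate⁺ (proj₁ (∈colouredNeighbours⁻ w∈))

  ∣usedColours∣≤∣colouredNeighbours∣ : ∀ v → ∣ usedColours v ∣ ≤ ∣ colouredNeighbours v ∣
  ∣usedColours∣≤∣colouredNeighbours∣ v =
    ≤-trans (p⊆q⇒∣p∣≤∣q∣ (usedColours⊆⋃colourOf v))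
            (∣⋃∣≤∣support∣ (colourOf v) (colouredNeighbours v) (∣colourOf∣≤1 v)
                           ∈colourOf⇒∈colouredNeighbours)

  ∣usedColours∣≤deg : ∀ v → ∣ usedColours v ∣ ≤ deg G v
  ∣usedColours∣≤deg v =
    ≤-trans (∣usedColours∣≤∣colouredNeighbours∣ v) (p⊆q⇒∣p∣≤∣q∣ colouredNeighbours⊆neighbours)

  ∣usedColours∣<deg : ∀ {v w} → adj G v w ≡ true → π v w ≡ nothing → ∣ usedColours v ∣ < deg G v
  ∣usedColours∣<deg {v} {w} vw∈G uncoloured =
    ≤-<-trans (∣usedColours∣≤∣colouredNeighbours∣ v)
              (p⊂q⇒∣p∣<∣q∣ (colouredNeighbours⊆neighbours , w , w∈neighbours , w∉coloured))
    where
    w∈neighbours : w ∈ neighbours v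
    w∈neighbours = ∈-tabulate⁺ (Equivalence.from T-≡ vw∈G)
    w∉coloured : w ∉ colouredNeighbours v
    w∉coloured w∈ = subst (T ∘ is-just) uncoloured (proj₂ (∈colouredNeighbours⁻ w∈))

  D∸deg<∣missing∣ : ∀ {v w} → deg G v ≤ D → adj G v w ≡ true → π v w ≡ nothing →
                    D ∸ deg G v < ∣ missing G π v ∣
  D∸deg<∣missing∣ {v} deg≤D vw∈G uncoloured =
    subst (D ∸ deg G v <_) (sym (∣missing∣≡D∸∣usedColours∣ v))
          (∸-monoʳ-< (∣usedColours∣<deg vw∈G uncoloured) deg≤D)

  0<∣missing∣ : ∀ {v} → deg G v < D → 0 < ∣ missing G π v ∣
  0<∣missing∣ {v} deg<D =
    subst (0 <_) (sym (∣missing∣≡D∸∣usedColours∣ v))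
          (m<n⇒0<n∸m (≤-<-trans (∣usedColours∣≤deg v) deg<D))

  ∣fanMissing∣≡sum : ∀ {x} m (ys : Fin (suc m) → Fin n) → ¬ Active G π x m ys →
                     ∣ fanMissing G π m ys ∣ ≡ sum (tabulateᴸ (λ i → ∣ missing G π (ys i) ∣))
  ∣fanMissing∣≡sum m ys inactive =
    trans (cong (∣_∣ ∘ ⋃) (map-tabulate (λ i → i) (missing G π ∘ ys)))
          (∣⋃-tabulate∣≡sum disjoint)
    where
    disjoint : ∀ {i j} → i ≢ j → Disjoint (missing G π (ys i)) (missing G π (ys j))
    disjoint {i} {j} i≢j (c , c∈∩) = inactive (inj₂ (i , j , i≢j , c , x∈p∩q⁻ _ _ c∈∩))

lemma6 : ∀ {n} (G : Graph n) (D : ℕ) → 1 ≤ D → maxDeg≤ G D →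
    (π : Colouring n D) → IsPartialColouring G D π →
    (x : Fin n) (m : ℕ) (ys : Fin (suc m) → Fin n) → IsFan G π x m ys →
    ¬ Active G π x m ys →
    D ∸ deg G (ys zero) + suc m ≤ ∣ fanMissing G π m ys ∣
lemma6 {n} G D _ maxDeg π colouring x m ys fan inactive = begin
  D ∸ deg G y₁ + suc m                            ≡⟨ +-suc (D ∸ deg G y₁) m ⟩
  suc (D ∸ deg G y₁) + m                          ≤⟨ +-mono-≤ y₁-bound (k≤sum-tabulate others-nonempty) ⟩
  sum (tabulateᴸ (λ i → ∣ missing G π (ys i) ∣))  ≡⟨ sym (∣fanMissing∣≡sum G π m ys inactive) ⟩
  ∣ fanMissing G π m ys ∣                         ∎
  where
  open ≤-Reasoning
  y₁ : Fin n
  y₁ = ys zero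
  y₁-bound : D ∸ deg G y₁ < ∣ missing G π y₁ ∣
  y₁-bound = D∸deg<∣missing∣ G π (maxDeg y₁)
    (trans (Graph.sym G y₁ x) (IsFan.nbr fan zero))
    (trans (IsPartialColouring.symm colouring y₁ x) (IsFan.uncol fan))
  others-nonempty : ∀ i → 0 < ∣ missing G π (ys (fsuc i)) ∣
  others-nonempty i = 0<∣missing∣ G π (IsFan.lowdeg fan i)
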